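{- Let $\mathcal{L}$ be the set of all factors of words in $\mu(\{0,1\}^*)$, where $\mu$ is the Thue–Morse morphism $\mu(0)=01$, $\mu(1)=10$. Let $\alpha > 2$ be a real number and let $r = \lceil \alpha \rceil$. Let $v \in \{0,1\}^*$ be such that $00v \in \mathcal{L}$ and $00v$ is $\alpha$ power-free. Suppose that $0^r v = xuy$ for words $x, u, y$, where $u$ is a nonempty word having a period $p$ with $|u|/p \geq \alpha$. Then $x = \epsilon$ (the empty word) and $u = 0^r$.
   Context: A word $u = u_1\cdots u_m$ has period $p$ ($1 \le p \le m$) if $u_i = u_{i+p}$ for all $1 \le i \le m-p$; then $u$ is a $\beta$ power with $\beta = |u|/p$. A word is $\alpha$ power-free if none of its subwords is a $\beta$ power with $\beta \geq \alpha$, i.e. no subword $u$ has a period $p$ with $|u|/p \ge \alpha$. -}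

module Defs where

open import Data.Nat using (ℕ; zero; suc; _+_; _<_; _≤_)
open import Data.Fin using (Fin)
open import Data.List using (List; []; _∷_; _++_; length; concatMap; replicate)
open import Data.Maybe using (Maybe; just; nothing)
open import Data.Integer using (+_)
open import Data.Rational.Unnormalised using (ℚᵘ; mkℚᵘ; 0ℚᵘ) renaming (_≤_ to _≤ᵘ_; _<_ to _<ᵘ_)
open import Data.Product using (Σ; ∃; _×_)
open import Relation.Binary.PropositionalEquality using (_≡_)
open import Relation.Nullary using (¬_)

Word : Set
Word = List (Fin 2)

μ₁ : Fin 2 → Word
μ₁ Fin.zero = Fin.zero ∷ Fin.suc Fin.zero ∷ []
μ₁ (Fin.suc Fin.zero) = Fin.suc Fin.zero ∷ Fin.zero ∷ []

μ : Word → Word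
μ = concatMap μ₁

InL : Word → Set
InL v = ∃ λ w → ∃ λ x → ∃ λ y → x ++ v ++ y ≡ μ w

at : Word → ℕ → Maybe (Fin 2)
at []      _       = nothing
at (a ∷ u) zero    = just a
at (a ∷ u) (suc i) = at u i

HasPeriod : Word → ℕ → Set
HasPeriod u p = (1 ≤ p) × (p ≤ length u) ×
  (∀ i → i + p < length u → at u i ≡ at u (i + p))

-- the rational n/p (p = 0 never used, since periods are ≥ 1)
_÷_ : ℕ → ℕ → ℚᵘ
n ÷ zero  = 0ℚᵘ
n ÷ suc k = mkℚᵘ (+ n) k

-- A real number α, represented by its upper set U = {q ∈ ℚ : q ≥ α}
-- (complement of a Dedekind lower cut): upward closed, inhabited,
-- and the complement {q : q < α} is rounded (open).
record Real : Set₁ where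
  field
    Ge        : ℚᵘ → Set          -- Ge q  means  q ≥ α
    up-closed : ∀ {q q'} → q ≤ᵘ q' → Ge q → Ge q'
    inhabited : ∃ λ q → Ge q
    rounded   : ∀ q → ¬ Ge q → ∃ λ q' → q <ᵘ q' × ¬ Ge q'
open Real public

PowerFree : Real → Word → Set
PowerFree α w = ∀ x u y → w ≡ x ++ u ++ y → ∀ p → HasPeriod u p →
  ¬ Ge α (length u ÷ p)

𝟘 : Fin 2
𝟘 = Fin.zero

-- A factor of μ({0,1}*) never contains 000, so in 0ʳv the block 0ʳ is followed by a 1
-- and v contains no 000.  Let u have period p with |u| > 2p.  If u starts within the
-- last two letters of the block, it is a factor of 00v, which is α power-free.
-- Otherwise k ≥ 3 letters of the block remain from the start of u on, and u cannot
-- reach beyond the block: a period p ≤ k would copy a 0 onto the 1 after the block,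
-- and a longer period would copy the three leading 0s of u onto a 000 in v.  So x and
-- u are runs of 0s with |x| + |u| ≤ r, while |u| > (r - 1)p ≥ r - 1.
module Submission where

open import Defs
open import Data.Nat using (ℕ; zero; suc; _+_; _*_; _∸_; _≤_; _<_; z≤n; s≤s; _≤?_; >-nonZero)
open import Data.Nat.Properties
open import Data.Fin using (Fin)
open import Data.Maybe using (just)
open import Data.List using (List; []; _∷_; _++_; length; replicate)
open import Data.List.Properties using (∷-injective; ∷-injectiveʳ)
open import Data.Product using (_×_; _,_; ∃)
open import Data.Sum using (_⊎_; inj₁; inj₂)
open import Data.Empty using (⊥; ⊥-elim)
open import Data.Integer using (+≤+) renaming (_≤_ to _≤ℤ_)
open import Data.Integer.Properties using (pos-*)
open import Data.Rational.Unnormalised using (*≤*) renaming (_≤_ to _≤ᵘ_)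
open import Relation.Binary.PropositionalEquality
open import Relation.Nullary using (¬_; Dec; yes; no)

÷-mono : ∀ {m n p q} → m * suc q ≤ n * suc p → m ÷ suc p ≤ᵘ n ÷ suc q
÷-mono {m} {n} {p} {q} h = *≤* (subst₂ _≤ℤ_ (pos-* m (suc q)) (pos-* n (suc p)) (+≤+ h))

exponent-below⇒< : ∀ (α : Real) {n m p} → 1 ≤ p →
                   ¬ Ge α (n ÷ 1) → Ge α (m ÷ p) → n * p < m
exponent-below⇒< α {n} {m} {suc p} _ α≰n α≤m/p with m ≤? n * suc p
... | yes m≤np = ⊥-elim (α≰n (up-closed α (÷-mono (subst (_≤ n * suc p) (sym (*-identityʳ m)) m≤np)) α≤m/p))
... | no m≰np = ≰⇒> m≰np

module _ {A : Set} {c : A} where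

  replicate-suc-++ : ∀ n {w : List A} → replicate (suc n) c ++ w ≡ replicate n c ++ c ∷ w
  replicate-suc-++ zero    = refl
  replicate-suc-++ (suc n) = cong (c ∷_) (replicate-suc-++ n)

  prefix-of-replicate : ∀ {n w} u {t} → length u ≤ n →
                        replicate n c ++ w ≡ u ++ t → u ≡ replicate (length u) c
  prefix-of-replicate []      _           _  = refl
  prefix-of-replicate (a ∷ u) (s≤s |u|≤n) eq with ∷-injective eq
  ... | refl , eq′ = cong (c ∷_) (prefix-of-replicate u |u|≤n eq′)

  prefix-within-replicate : ∀ {n w} x {t} → length x ≤ n →
                            replicate n c ++ w ≡ x ++ t → replicate (n ∸ length x) c ++ w ≡ t
  prefix-within-replicate []      _           eq = eq
  prefix-within-replicate (a ∷ x) (s≤s |x|≤n) eq = prefix-within-replicate x |x|≤n (∷-injectiveʳ eq)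

  prefix-beyond-replicate : ∀ {n w} x {t} → n ≤ length x →
                            replicate n c ++ w ≡ x ++ t → ∃ λ x′ → w ≡ x′ ++ t
  prefix-beyond-replicate {zero}  x       _           eq = x , eq
  prefix-beyond-replicate {suc n} (a ∷ x) (s≤s n≤|x|) eq = prefix-beyond-replicate x n≤|x| (∷-injectiveʳ eq)

at-++ˡ : ∀ u {y j} → j < length u → at (u ++ y) j ≡ at u j
at-++ˡ (a ∷ u) {j = zero}  _           = refl
at-++ˡ (a ∷ u) {j = suc j} (s≤s j<|u|) = at-++ˡ u j<|u|

at-++ˡ-just : ∀ u {y j a} → at u j ≡ just a → at (u ++ y) j ≡ just a
at-++ˡ-just (b ∷ u) {j = zero}  e = e
at-++ˡ-just (b ∷ u) {j = suc j} e = at-++ˡ-just u e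

at-replicate-++ˡ : ∀ {c} k {v j} → j < k → at (replicate k c ++ v) j ≡ just c
at-replicate-++ˡ (suc k) {j = zero}  _         = refl
at-replicate-++ˡ (suc k) {j = suc j} (s≤s j<k) = at-replicate-++ˡ k j<k

at-replicate-++ʳ : ∀ {c} k {v} j → at (replicate k c ++ v) (k + j) ≡ at v j
at-replicate-++ʳ zero    j = refl
at-replicate-++ʳ (suc k) j = at-replicate-++ʳ k j

No000 : Word → Set
No000 w = ∀ i → at w i ≡ just 𝟘 → at w (1 + i) ≡ just 𝟘 → at w (2 + i) ≡ just 𝟘 → ⊥

No000-++⁻ʳ : ∀ x {w} → No000 (x ++ w) → No000 w
No000-++⁻ʳ []      no000 = no000
No000-++⁻ʳ (a ∷ x) no000 = No000-++⁻ʳ x (λ i → no000 (suc i))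

No000-++⁻ˡ : ∀ w {y} → No000 (w ++ y) → No000 w
No000-++⁻ˡ w no000 i e₀ e₁ e₂ = no000 i (at-++ˡ-just w e₀) (at-++ˡ-just w e₁) (at-++ˡ-just w e₂)

μ-starts-with-01-or-10 : ∀ w → at (μ w) 0 ≡ just 𝟘 → at (μ w) 1 ≡ just 𝟘 → ⊥
μ-starts-with-01-or-10 []                     ()
μ-starts-with-01-or-10 (Fin.zero ∷ w)         _  ()
μ-starts-with-01-or-10 (Fin.suc Fin.zero ∷ w) ()

No000-μ : ∀ w → No000 (μ w)
No000-μ []                     _             ()
No000-μ (Fin.zero ∷ w)         zero          _ ()
No000-μ (Fin.suc Fin.zero ∷ w) zero          ()
No000-μ (Fin.zero ∷ w)         (suc zero)    ()
No000-μ (Fin.suc Fin.zero ∷ w) (suc zero)    _  e₁ e₂ = μ-starts-with-01-or-10 w e₁ e₂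
No000-μ (Fin.zero ∷ w)         (suc (suc i)) = No000-μ w i
No000-μ (Fin.suc Fin.zero ∷ w) (suc (suc i)) = No000-μ w i

InL⇒No000 : ∀ {w} → InL w → No000 w
InL⇒No000 {w} (t , x , y , eq) =
  No000-++⁻ˡ w (No000-++⁻ʳ x (subst No000 (sym eq) (No000-μ t)))

periodic-prefix-within-block : ∀ {k v u y p} → 3 ≤ k → ¬ at v 0 ≡ just 𝟘 → No000 v →
                               replicate k 𝟘 ++ v ≡ u ++ y → HasPeriod u p → 2 * p < length u →
                               length u ≤ k
periodic-prefix-within-block {k} {v} {u} {y} {p} 3≤k v₀≢𝟘 no000 eq (1≤p , _ , periodic) 2p<|u|
  with length u ≤? k
... | yes |u|≤k = |u|≤k
... | no  |u|≰k = ⊥-elim (overrun (p ≤? k))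
  where
  open ≡-Reasoning

  k<|u| : k < length u
  k<|u| = ≰⇒> |u|≰k

  u-at : ∀ {j} → j < length u → at u j ≡ at (replicate k 𝟘 ++ v) j
  u-at j<|u| = trans (sym (at-++ˡ u j<|u|)) (cong (λ w → at w _) (sym eq))

  in-block : ∀ {j} → j < k → at u j ≡ just 𝟘
  in-block j<k = trans (u-at (<-trans j<k k<|u|)) (at-replicate-++ˡ k j<k)

  beyond-block : ∀ j → k + j < length u → at u (k + j) ≡ at v j
  beyond-block j lt = trans (u-at lt) (at-replicate-++ʳ k j)

  overrun : Dec (p ≤ k) → ⊥
  overrun (yes p≤k) = v₀≢𝟘 (begin
    at v 0            ≡⟨ sym (beyond-block 0 (subst (_< length u) (sym (+-identityʳ k)) k<|u|)) ⟩
    at u (k + 0)      ≡⟨ cong (at u) (trans (+-identityʳ k) (sym (m∸n+n≡m p≤k))) ⟩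
    at u (k ∸ p + p)  ≡⟨ sym (periodic (k ∸ p) (subst (_< length u) (sym (m∸n+n≡m p≤k)) k<|u|)) ⟩
    at u (k ∸ p)      ≡⟨ in-block (∸-monoʳ-< 1≤p p≤k) ⟩
    just 𝟘            ∎)
  overrun (no p≰k) = no000 q (copied-zero 0 (s≤s z≤n)) (copied-zero 1 (s≤s (s≤s z≤n)))
                             (copied-zero 2 (s≤s (s≤s (s≤s z≤n))))
    where
    k<p : k < p
    k<p = ≰⇒> p≰k

    q : ℕ
    q = p ∸ k

    shifted : ∀ j → k + (j + q) ≡ j + p
    shifted j = begin
      k + (j + q)  ≡⟨ cong (k +_) (+-comm j q) ⟩
      k + (q + j)  ≡⟨ sym (+-assoc k q j) ⟩
      k + q + j    ≡⟨ cong (_+ j) (m+[n∸m]≡n (<⇒≤ k<p)) ⟩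
      p + j        ≡⟨ +-comm p j ⟩
      j + p        ∎

    j+p<|u| : ∀ {j} → j < p → j + p < length u
    j+p<|u| j<p = <-trans (+-monoˡ-< p j<p) (subst (_< length u) (cong (p +_) (+-identityʳ p)) 2p<|u|)

    copied-zero : ∀ j → j < 3 → at v (j + q) ≡ just 𝟘
    copied-zero j j<3 = begin
      at v (j + q)      ≡⟨ sym (beyond-block (j + q) (subst (_< length u) (sym (shifted j)) j+p<|u|′)) ⟩
      at u (k + (j + q)) ≡⟨ cong (at u) (shifted j) ⟩
      at u (j + p)      ≡⟨ sym (periodic j j+p<|u|′) ⟩
      at u j            ≡⟨ in-block j<k ⟩
      just 𝟘            ∎
      where
      j<k : j < k
      j<k = <-≤-trans j<3 3≤k
      j+p<|u|′ : j + p < length u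
      j+p<|u|′ = j+p<|u| (<-trans j<k k<p)

periodic-factor-of-zero-block : ∀ r {v x u y p} → No000 (𝟘 ∷ 𝟘 ∷ v) →
  replicate r 𝟘 ++ v ≡ x ++ u ++ y → HasPeriod u p → 2 * p < length u →
  (∃ λ x′ → 𝟘 ∷ 𝟘 ∷ v ≡ x′ ++ u ++ y) ⊎
  (x ≡ replicate (length x) 𝟘 × u ≡ replicate (length u) 𝟘 × length x + length u ≤ r)
periodic-factor-of-zero-block zero       {x = x} _ eq _ _ = inj₁ (𝟘 ∷ 𝟘 ∷ x , cong (λ w → 𝟘 ∷ 𝟘 ∷ w) eq)
periodic-factor-of-zero-block (suc zero) {x = x} _ eq _ _ = inj₁ (𝟘 ∷ x , cong (𝟘 ∷_) eq)
periodic-factor-of-zero-block r@(suc (suc n)) {v} {x} {u} {y} no000 eq per 2p<|u| with n ≤? length x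
... | yes n≤|x| = inj₁ (prefix-beyond-replicate x n≤|x| (trans (sym 00v-suffix) eq))
  where
  00v-suffix : replicate r 𝟘 ++ v ≡ replicate n 𝟘 ++ 𝟘 ∷ 𝟘 ∷ v
  00v-suffix = trans (replicate-suc-++ (suc n)) (replicate-suc-++ n)
... | no n≰|x| = inj₂ (prefix-of-replicate x |x|≤r eq , prefix-of-replicate u |u|≤k rest , |x|+|u|≤r)
  where
  3+|x|≤r : 3 + length x ≤ r
  3+|x|≤r = s≤s (s≤s (≰⇒> n≰|x|))

  |x|≤r : length x ≤ r
  |x|≤r = m+n≤o⇒n≤o 3 3+|x|≤r

  rest : replicate (r ∸ length x) 𝟘 ++ v ≡ u ++ y
  rest = prefix-within-replicate x |x|≤r eq

  |u|≤k : length u ≤ r ∸ length x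
  |u|≤k = periodic-prefix-within-block {u = u} (m+n≤o⇒m≤o∸n 3 3+|x|≤r) (no000 0 refl refl)
            (No000-++⁻ʳ (𝟘 ∷ 𝟘 ∷ []) no000) rest per 2p<|u|

  |x|+|u|≤r : length x + length u ≤ r
  |x|+|u|≤r = ≤-trans (+-monoʳ-≤ (length x) |u|≤k) (≤-reflexive (m+[n∸m]≡n |x|≤r))

lemma4 : (α : Real) → ¬ Ge α (2 ÷ 1) →
         (r : ℕ) → Ge α (r ÷ 1) → ¬ Ge α ((r ∸ 1) ÷ 1) →
         (v : Word) → InL (𝟘 ∷ 𝟘 ∷ v) → PowerFree α (𝟘 ∷ 𝟘 ∷ v) →
         (x u y : Word) → replicate r 𝟘 ++ v ≡ x ++ u ++ y → u ≢ [] →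
         (p : ℕ) → HasPeriod u p → Ge α (length u ÷ p) →
         (x ≡ []) × (u ≡ replicate r 𝟘)
lemma4 α α≰2 r _ α≰r-1 v 00v∈L 00v-free x u y eq _ p per@(1≤p , _) α≤|u|/p
  with periodic-factor-of-zero-block r (InL⇒No000 00v∈L) eq per (exponent-below⇒< α 1≤p α≰2 α≤|u|/p)
... | inj₁ (x′ , 00v≡x′uy) = ⊥-elim (00v-free x′ u y 00v≡x′uy p per α≤|u|/p)
... | inj₂ (x≡0s , u≡0s , |x|+|u|≤r) =
  trans x≡0s (cong (λ n → replicate n 𝟘) |x|≡0) , trans u≡0s (cong (λ n → replicate n 𝟘) |u|≡r)
  where
  r≤|u| : r ≤ length u
  r≤|u| = ≤-trans (m≤n+m∸n r 1)
            (≤-<-trans (m≤m*n (r ∸ 1) p {{>-nonZero 1≤p}}) (exponent-below⇒< α 1≤p α≰r-1 α≤|u|/p))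

  |x|≡0 : length x ≡ 0
  |x|≡0 = n≤0⇒n≡0 (+-cancelʳ-≤ (length u) (length x) 0 (≤-trans |x|+|u|≤r r≤|u|))

  |u|≡r : length u ≡ r
  |u|≡r = ≤-antisym (m+n≤o⇒n≤o (length x) |x|+|u|≤r) r≤|u|
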